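{- Let $b,k,w$ be positive integers with $b\ge6$ and $k\le w/2$, and let $\epsilon=k/w$. Then $P_{b,w}$ is $(\epsilon,k,\nu_b)$-normal, i.e. for every $m\le k$ and every block $B$ of length $m$, $$\nu_b(B)\,|P_{b,w}|\,(1-\epsilon)\le N(B,P_{b,w})\le \nu_b(B)\,|P_{b,w}|\,(1+\epsilon).$$
   Context: A block of length $m$ is an $m$-tuple of non-negative integers; $|y|$ denotes the length of a block $y$. For a positive integer $b$, define $\nu_b(j)=2^{ -b}$ for $0\le j\le b-1$, $\nu_b(b)=(2^b-b)/2^b$, $\nu_b(j)=0$ for $j>b$, and $\nu_b(c_1,\dots,c_m)=\prod_j\nu_b(c_j)$. Let $P_1,\dots,P_{(b+1)^w}$ be all blocks of length $w$ with digits in $\{0,\dots,b\}$, in lexicographic order, and let $P_{b,w}$ be the block obtained by concatenating $2^{bw}\nu_b(P_1)$ copies of $P_1$, then $2^{bw}\nu_b(P_2)$ copies of $P_2$, and so on up to $P_{(b+1)^w}$ (multiplicities $(2^b-b)^{g}$, $g$ = number of digits equal to $b$). For blocks $B,y$, $N(B,y)$ is the number of positions at which $B$ occurs as a contiguous subblock of $y$ (occurrences may overlap). -}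

module Defs where

open import Data.Nat as ℕ using (ℕ; zero; suc; _∸_; _^_; _<ᵇ_; _≡ᵇ_)
open import Data.Bool using (Bool; true; false; if_then_else_; _∧_)
open import Data.List using (List; []; _∷_; map; concatMap; concat; replicate; length; upTo)
open import Data.Nat.ListAction using (product)
open import Data.Integer using (+_)
open import Data.Rational using (ℚ; _/_; 0ℚ; 1ℚ; _*_)

Block : Set
Block = List ℕ

-- n / d as a rational, for d > 0 (d = 0 never used; gives 0).
frac : ℕ → ℕ → ℚ
frac n zero    = 0ℚ
frac n (suc d) = (+ n) / suc d

νd : ℕ → ℕ → ℚ
νd b j = if j <ᵇ b then frac 1 (2 ^ b)
         else if j ≡ᵇ b then frac (2 ^ b ∸ b) (2 ^ b)
         else 0ℚ

ν : ℕ → Block → ℚ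
ν b []       = 1ℚ
ν b (c ∷ cs) = νd b c * ν b cs

allBlocks : ℕ → ℕ → List Block
allBlocks b zero    = [] ∷ []
allBlocks b (suc w) = concatMap (λ d → map (d ∷_) (allBlocks b w)) (upTo (suc b))

-- 2^{b} ν_b(j) as a natural number (the multiplicity weight of a digit)
weight : ℕ → ℕ → ℕ
weight b j = if j <ᵇ b then 1 else if j ≡ᵇ b then 2 ^ b ∸ b else 0

-- multiplicity 2^{bw} ν_b(P) of a block P of length w
mult : ℕ → Block → ℕ
mult b P = product (map (weight b) P)

Pbw : ℕ → ℕ → Block
Pbw b w = concatMap (λ P → concat (replicate (mult b P) P)) (allBlocks b w)

isPrefix : Block → Block → Bool
isPrefix []       y        = true
isPrefix (x ∷ xs) []       = false
isPrefix (x ∷ xs) (y ∷ ys) = (x ≡ᵇ y) ∧ isPrefix xs ys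

N : Block → Block → ℕ
N B []       = 0
N B (y ∷ ys) = (if isPrefix B (y ∷ ys) then 1 else 0) ℕ.+ N B ys

{-# OPTIONS --safe #-}
-- P_{b,w} is the concatenation, over all words P of length w over {0,…,b}, of mult(P) = 2^{bw} ν_b(P)
-- copies of P. Let |B| = m, t = w − m and M = 2^{bm} ν_b(B); then ν_b(B) |P_{b,w}| = w M (2^b)^t.
-- Since mult is multiplicative, each of the t + 1 windows of a word of length w contains B with total
-- weight M (2^b)^t, so the occurrences inside single copies already number (t + 1) M (2^b)^t.
-- For the upper bound, an occurrence either starts inside a copy of P and is then an occurrence in the
-- cyclic word P, of which there are w M (2^b)^t in total, or it straddles the seam after the last copy
-- of P: at most m − 1 per seam, and there are (b+1)^w ≤ (2^b)^t seams because (b+1)^2 ≤ 2^b for b ≥ 6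
-- and w ≤ 2t. Hence (w − k) M (2^b)^t ≤ N(B, P_{b,w}) ≤ (w + k) M (2^b)^t.
module Submission where

open import Defs
open import Data.Nat as ℕ using (ℕ; zero; suc; _≤_; _<_; _*_; _+_; _∸_; _^_; _<ᵇ_; _≡ᵇ_; z≤n; s≤s)
open import Data.Nat.Properties
open import Data.Nat.Tactic.RingSolver using (solve-∀)
open import Data.Bool using (Bool; true; false; if_then_else_; _∧_; T)
import Data.Bool.Properties as Bool
open import Data.Unit using (tt)
open import Data.List using (List; []; _∷_; length; _++_; concat; map; replicate; upTo)
open import Data.List.Properties using (++-assoc; ++-identityʳ; length-++; applyUpTo-∷ʳ; length-map)
open import Data.List.Relation.Unary.All as All using (All; []; _∷_)
open import Data.List.Relation.Unary.All.Properties using (concat⁺; map⁺; applyUpTo⁺₁; applyUpTo⁺₂; replicate⁺)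
open import Data.Product using (_×_; _,_)
open import Data.Sum using (inj₁; inj₂)
open import Function using (_∘_)
open import Relation.Binary.PropositionalEquality
open import Relation.Binary.Definitions using (tri<; tri≈; tri>)
open import Relation.Nullary using (yes; no; ¬_; contradiction)
open import Algebra.Properties.CommutativeSemigroup +-commutativeSemigroup using (interchange)
open import Algebra.Properties.CommutativeSemigroup *-commutativeSemigroup
  using () renaming (x∙yz≈y∙xz to x*[y*z]≡y*[x*z])
open import Data.Integer as ℤ using (ℤ)
import Data.Integer.Properties as ℤ
import Data.Integer.Tactic.RingSolver as ℤ-Solver
open import Data.Rational as ℚ using (0ℚ; 1ℚ)
import Data.Rational.Properties as ℚ
open import Data.Rational.Unnormalised as ℚᵘ using (mkℚᵘ; *≡*; *≤*)
import Data.Rational.Unnormalised.Properties as ℚᵘ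

frac-0 : ∀ d → frac 0 d ≡ 0ℚ
frac-0 zero    = refl
frac-0 (suc d) = ℚ.0/n≡0 (suc d)

toℚᵘ-frac : ∀ a d → ℚ.toℚᵘ (frac a (suc d)) ℚᵘ.≃ mkℚᵘ (ℤ.+ a) d
toℚᵘ-frac a d = ℚ.toℚᵘ-fromℚᵘ (mkℚᵘ (ℤ.+ a) d)

frac-cong : ∀ a b c d → 1 ≤ c → 1 ≤ d → a * d ≡ b * c → frac a c ≡ frac b d
frac-cong a b (suc c) (suc d) _ _ eq = ℚ.toℚᵘ-injective (begin
  ℚ.toℚᵘ (frac a (suc c)) ≈⟨ toℚᵘ-frac a c ⟩
  mkℚᵘ (ℤ.+ a) c          ≈⟨ *≡* (trans (sym (ℤ.pos-* a (suc d))) (trans (cong ℤ.+_ eq) (ℤ.pos-* b (suc c)))) ⟩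
  mkℚᵘ (ℤ.+ b) d          ≈⟨ ℚᵘ.≃-sym (toℚᵘ-frac b d) ⟩
  ℚ.toℚᵘ (frac b (suc d)) ∎)
  where open ℚᵘ.≃-Reasoning

frac-*-frac : ∀ a b c d → frac a c ℚ.* frac b d ≡ frac (a * b) (c * d)
frac-*-frac a b zero    d       = ℚ.*-zeroˡ (frac b d)
frac-*-frac a b (suc c) zero    rewrite *-zeroʳ c = ℚ.*-zeroʳ (frac a (suc c))
frac-*-frac a b (suc c) (suc d) = ℚ.toℚᵘ-injective (begin
  ℚ.toℚᵘ (frac a (suc c) ℚ.* frac b (suc d))
    ≈⟨ ℚ.toℚᵘ-homo-* (frac a (suc c)) (frac b (suc d)) ⟩
  ℚ.toℚᵘ (frac a (suc c)) ℚᵘ.* ℚ.toℚᵘ (frac b (suc d))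
    ≈⟨ ℚᵘ.*-cong (toℚᵘ-frac a c) (toℚᵘ-frac b d) ⟩
  mkℚᵘ (ℤ.+ a ℤ.* ℤ.+ b) (d + c * suc d)
    ≡⟨ cong (λ z → mkℚᵘ z (d + c * suc d)) (sym (ℤ.pos-* a b)) ⟩
  mkℚᵘ (ℤ.+ (a * b)) (d + c * suc d)
    ≈⟨ ℚᵘ.≃-sym (toℚᵘ-frac (a * b) (d + c * suc d)) ⟩
  ℚ.toℚᵘ (frac (a * b) (suc c * suc d)) ∎)
  where open ℚᵘ.≃-Reasoning

frac-mono : ∀ {a b} → a ≤ b → frac a 1 ℚ.≤ frac b 1
frac-mono {a} {b} a≤b = ℚ.toℚᵘ-cancel-≤
  (ℚᵘ.≤-respˡ-≃ (ℚᵘ.≃-sym (toℚᵘ-frac a 0)) (ℚᵘ.≤-respʳ-≃ (ℚᵘ.≃-sym (toℚᵘ-frac b 0))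
    (*≤* (subst₂ ℤ._≤_ (ℤ.pos-* a 1) (ℤ.pos-* b 1) (ℤ.+≤+ (*-monoˡ-≤ 1 a≤b))))))

1-frac : ∀ k w → k ≤ suc w → 1ℚ ℚ.- frac k (suc w) ≡ frac (suc w ∸ k) (suc w)
1-frac k w k≤w = ℚ.toℚᵘ-injective (begin
  ℚ.toℚᵘ (1ℚ ℚ.- frac k (suc w))
    ≈⟨ ℚ.toℚᵘ-homo-+ 1ℚ (ℚ.- frac k (suc w)) ⟩
  ℚᵘ.1ℚᵘ ℚᵘ.+ ℚ.toℚᵘ (ℚ.- frac k (suc w))
    ≈⟨ ℚᵘ.+-congʳ ℚᵘ.1ℚᵘ (ℚᵘ.≃-trans (ℚ.toℚᵘ-homo‿- (frac k (suc w))) (ℚᵘ.-‿cong (toℚᵘ-frac k w))) ⟩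
  ℚᵘ.1ℚᵘ ℚᵘ.- mkℚᵘ (ℤ.+ k) w
    ≈⟨ *≡* (trans (cross (ℤ.+ suc w) (ℤ.+ k))
                  (cong (ℤ._* (ℤ.+ 1 ℤ.* ℤ.+ suc w)) (trans (ℤ.m-n≡m⊖n (suc w) k) (ℤ.⊖-≥ k≤w)))) ⟩
  mkℚᵘ (ℤ.+ (suc w ∸ k)) w
    ≈⟨ ℚᵘ.≃-sym (toℚᵘ-frac (suc w ∸ k) w) ⟩
  ℚ.toℚᵘ (frac (suc w ∸ k) (suc w)) ∎)
  where
  open ℚᵘ.≃-Reasoning
  cross : ∀ (W K : ℤ) → (ℤ.+ 1 ℤ.* W ℤ.+ ℤ.- K ℤ.* ℤ.+ 1) ℤ.* W ≡ (W ℤ.- K) ℤ.* (ℤ.+ 1 ℤ.* W)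
  cross = ℤ-Solver.solve-∀

1+frac : ∀ k w → 1ℚ ℚ.+ frac k (suc w) ≡ frac (suc w + k) (suc w)
1+frac k w = ℚ.toℚᵘ-injective (begin
  ℚ.toℚᵘ (1ℚ ℚ.+ frac k (suc w))
    ≈⟨ ℚ.toℚᵘ-homo-+ 1ℚ (frac k (suc w)) ⟩
  ℚᵘ.1ℚᵘ ℚᵘ.+ ℚ.toℚᵘ (frac k (suc w))
    ≈⟨ ℚᵘ.+-congʳ ℚᵘ.1ℚᵘ (toℚᵘ-frac k w) ⟩
  ℚᵘ.1ℚᵘ ℚᵘ.+ mkℚᵘ (ℤ.+ k) w
    ≈⟨ *≡* (trans (cross (ℤ.+ suc w) (ℤ.+ k)) (cong (ℤ._* (ℤ.+ 1 ℤ.* ℤ.+ suc w)) (sym (ℤ.pos-+ (suc w) k)))) ⟩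
  mkℚᵘ (ℤ.+ (suc w + k)) w
    ≈⟨ ℚᵘ.≃-sym (toℚᵘ-frac (suc w + k) w) ⟩
  ℚ.toℚᵘ (frac (suc w + k) (suc w)) ∎)
  where
  open ℚᵘ.≃-Reasoning
  cross : ∀ (W K : ℤ) → (ℤ.+ 1 ℤ.* W ℤ.+ K ℤ.* ℤ.+ 1) ℤ.* W ≡ (W ℤ.+ K) ℤ.* (ℤ.+ 1 ℤ.* W)
  cross = ℤ-Solver.solve-∀

𝟙 : Bool → ℕ
𝟙 x = if x then 1 else 0

𝟙≤1 : ∀ x → 𝟙 x ≤ 1
𝟙≤1 true  = ≤-refl
𝟙≤1 false = z≤n

occ : Block → Block → ℕ
occ B y = 𝟙 (isPrefix B y)

Nin : Block → Block → Block → ℕ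
Nin B []       ys = 0
Nin B (x ∷ xs) ys = occ B (x ∷ xs ++ ys) + Nin B xs ys

N-++ : ∀ B xs ys → N B (xs ++ ys) ≡ Nin B xs ys + N B ys
N-++ B []       ys = refl
N-++ B (x ∷ xs) ys = trans (cong (occ B (x ∷ xs ++ ys) +_) (N-++ B xs ys))
                           (sym (+-assoc (occ B (x ∷ xs ++ ys)) _ _))

N≡Nin : ∀ B xs → N B xs ≡ Nin B xs []
N≡Nin B xs = trans (cong (N B) (sym (++-identityʳ xs))) (trans (N-++ B xs []) (+-identityʳ _))

isPrefix-++ : ∀ B xs ys → isPrefix B xs ≡ true → isPrefix B (xs ++ ys) ≡ true
isPrefix-++ []      xs       ys _ = refl
isPrefix-++ (c ∷ B) (x ∷ xs) ys e with c ≡ᵇ x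
... | true = isPrefix-++ B xs ys e

isPrefix-++-long : ∀ B xs ys → length B ≤ length xs → isPrefix B (xs ++ ys) ≡ isPrefix B xs
isPrefix-++-long []      xs       ys _         = refl
isPrefix-++-long (c ∷ B) (x ∷ xs) ys (s≤s B≤xs) = cong ((c ≡ᵇ x) ∧_) (isPrefix-++-long B xs ys B≤xs)

isPrefix-short : ∀ B y → length y < length B → isPrefix B y ≡ false
isPrefix-short (c ∷ B) []      _          = refl
isPrefix-short (c ∷ B) (x ∷ y) (s≤s y<B) rewrite isPrefix-short B y y<B = Bool.∧-zeroʳ (c ≡ᵇ x)

occ-++ : ∀ B xs ys → occ B xs ≤ occ B (xs ++ ys)
occ-++ B xs ys with isPrefix B xs in eq
... | true  rewrite isPrefix-++ B xs ys eq = ≤-refl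
... | false = z≤n

N-short : ∀ B y → length y < length B → N B y ≡ 0
N-short B []      _   = refl
N-short B (x ∷ y) y<B rewrite isPrefix-short B (x ∷ y) y<B = N-short B y (<-trans (n<1+n _) y<B)

Nin-++ʳ : ∀ B xs ys zs → length B ≤ suc (length ys) → Nin B xs (ys ++ zs) ≡ Nin B xs ys
Nin-++ʳ B []       ys zs _   = refl
Nin-++ʳ B (x ∷ xs) ys zs B≤ = cong₂ _+_ first (Nin-++ʳ B xs ys zs B≤)
  where
  first : occ B (x ∷ xs ++ ys ++ zs) ≡ occ B (x ∷ xs ++ ys)
  first = trans (cong (λ z → occ B (x ∷ z)) (sym (++-assoc xs ys zs)))
            (cong 𝟙 (isPrefix-++-long B (x ∷ xs ++ ys) zs
              (≤-trans B≤ (s≤s (subst (length ys ≤_) (sym (length-++ xs)) (m≤n+m _ _))))))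

Nin-++ˡ : ∀ B xs ys zs → Nin B (xs ++ ys) zs ≡ Nin B xs (ys ++ zs) + Nin B ys zs
Nin-++ˡ B []       ys zs = refl
Nin-++ˡ B (x ∷ xs) ys zs = trans (cong₂ _+_ (cong (λ z → occ B (x ∷ z)) (++-assoc xs ys zs)) (Nin-++ˡ B xs ys zs))
                                 (sym (+-assoc (occ B (x ∷ xs ++ ys ++ zs)) _ _))

Nin≤length : ∀ B xs ys → Nin B xs ys ≤ length xs
Nin≤length B []       ys = z≤n
Nin≤length B (x ∷ xs) ys = +-mono-≤ (𝟙≤1 _) (Nin≤length B xs ys)

Nin-monoʳ : ∀ B xs ys → Nin B xs [] ≤ Nin B xs ys
Nin-monoʳ B []       ys = z≤n
Nin-monoʳ B (x ∷ xs) ys = +-mono-≤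
  (subst (λ z → occ B (x ∷ z) ≤ occ B (x ∷ xs ++ ys)) (sym (++-identityʳ xs)) (occ-++ B (x ∷ xs) ys))
  (Nin-monoʳ B xs ys)

-- Only the last length B ∸ 1 starting positions of xs can see past its end.
Nin-overhang : ∀ B xs ys → Nin B xs ys ≤ Nin B xs [] + (length B ∸ 1)
Nin-overhang B []       ys = z≤n
Nin-overhang B (x ∷ xs) ys with length B ≤? suc (length xs)
... | yes B≤ = begin
  occ B (x ∷ xs ++ ys) + Nin B xs ys
    ≡⟨ cong (λ z → 𝟙 z + Nin B xs ys) (trans (isPrefix-++-long B (x ∷ xs) ys B≤)
                                              (cong (λ z → isPrefix B (x ∷ z)) (sym (++-identityʳ xs)))) ⟩
  occ B (x ∷ xs ++ []) + Nin B xs ys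
    ≤⟨ +-monoʳ-≤ (occ B (x ∷ xs ++ [])) (Nin-overhang B xs ys) ⟩
  occ B (x ∷ xs ++ []) + (Nin B xs [] + (length B ∸ 1))
    ≡⟨ sym (+-assoc (occ B (x ∷ xs ++ [])) _ _) ⟩
  occ B (x ∷ xs ++ []) + Nin B xs [] + (length B ∸ 1) ∎
  where open ≤-Reasoning
... | no B≰ = ≤-trans (Nin≤length B (x ∷ xs) ys)
                      (≤-trans (∸-monoˡ-≤ 1 (≰⇒> B≰)) (m≤n+m _ _))

N-superadditive : ∀ B xs ys → N B xs + N B ys ≤ N B (xs ++ ys)
N-superadditive B xs ys rewrite N-++ B xs ys | N≡Nin B xs = +-monoˡ-≤ (N B ys) (Nin-monoʳ B xs ys)

repeat : ℕ → Block → Block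
repeat r P = concat (replicate r P)

-- For length B ≤ suc (length P) this counts the occurrences of B in the cyclic word P.
Ncyc : Block → Block → ℕ
Ncyc B P = Nin B P P

length-repeat : ∀ r P → length (repeat r P) ≡ r * length P
length-repeat zero    P = refl
length-repeat (suc r) P = trans (length-++ P) (cong (length P +_) (length-repeat r P))

N-repeat : ∀ B r P → r * N B P ≤ N B (repeat r P)
N-repeat B zero    P = z≤n
N-repeat B (suc r) P = ≤-trans (+-monoʳ-≤ (N B P) (N-repeat B r P)) (N-superadditive B P (repeat r P))

N-repeat-++ : ∀ B r P ys → length B ≤ length P →
  N B (repeat r P ++ ys) ≤ r * Ncyc B P + (length B ∸ 1) + N B ys
N-repeat-++ B zero          P ys _   = m≤n+m (N B ys) _
N-repeat-++ B (suc zero)    P ys _   = begin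
  N B ((P ++ []) ++ ys)                 ≡⟨ cong (N B) (cong (_++ ys) (++-identityʳ P)) ⟩
  N B (P ++ ys)                         ≡⟨ N-++ B P ys ⟩
  Nin B P ys + N B ys                   ≤⟨ +-monoˡ-≤ (N B ys) (Nin-overhang B P ys) ⟩
  Nin B P [] + (length B ∸ 1) + N B ys  ≤⟨ +-monoˡ-≤ (N B ys) (+-monoˡ-≤ (length B ∸ 1)
                                             (≤-trans (Nin-monoʳ B P P) (m≤m+n _ 0))) ⟩
  1 * Ncyc B P + (length B ∸ 1) + N B ys ∎
  where open ≤-Reasoning
N-repeat-++ B (suc (suc r)) P ys B≤P = begin
  N B ((P ++ repeat (suc r) P) ++ ys)
    ≡⟨ trans (cong (N B) (++-assoc P (repeat (suc r) P) ys)) (N-++ B P (repeat (suc r) P ++ ys)) ⟩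
  Nin B P ((P ++ repeat r P) ++ ys) + N B (repeat (suc r) P ++ ys)
    ≡⟨ cong (_+ N B (repeat (suc r) P ++ ys))
         (trans (cong (Nin B P) (++-assoc P (repeat r P) ys)) (Nin-++ʳ B P P (repeat r P ++ ys) (≤-trans B≤P (n≤1+n _)))) ⟩
  Ncyc B P + N B (repeat (suc r) P ++ ys)
    ≤⟨ +-monoʳ-≤ (Ncyc B P) (N-repeat-++ B (suc r) P ys B≤P) ⟩
  Ncyc B P + (suc r * Ncyc B P + (length B ∸ 1) + N B ys)
    ≡⟨ trans (sym (+-assoc (Ncyc B P) _ (N B ys))) (cong (_+ N B ys) (sym (+-assoc (Ncyc B P) _ _))) ⟩
  suc (suc r) * Ncyc B P + (length B ∸ 1) + N B ys ∎
  where open ≤-Reasoning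

expand : ℕ → Block → Block
expand b P = repeat (mult b P) P

blockSum : ℕ → List Block → (Block → ℕ) → ℕ
blockSum b []       f = 0
blockSum b (P ∷ Ps) f = mult b P * f P + blockSum b Ps f

length-concat-expand : ∀ b Ps → length (concat (map (expand b) Ps)) ≡ blockSum b Ps length
length-concat-expand b []       = refl
length-concat-expand b (P ∷ Ps) = trans (length-++ (expand b P))
  (cong₂ _+_ (length-repeat (mult b P) P) (length-concat-expand b Ps))

N-concat-expand-lower : ∀ b B Ps → blockSum b Ps (N B) ≤ N B (concat (map (expand b) Ps))
N-concat-expand-lower b B []       = z≤n
N-concat-expand-lower b B (P ∷ Ps) = ≤-trans
  (+-mono-≤ (N-repeat B (mult b P) P) (N-concat-expand-lower b B Ps))
  (N-superadditive B (expand b P) (concat (map (expand b) Ps)))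

N-concat-expand-upper : ∀ b B Ps → All (λ P → length B ≤ length P) Ps →
  N B (concat (map (expand b) Ps)) ≤ blockSum b Ps (Ncyc B) + length Ps * (length B ∸ 1)
N-concat-expand-upper b B []       []          = z≤n
N-concat-expand-upper b B (P ∷ Ps) (B≤P ∷ B≤Ps) = begin
  N B (expand b P ++ rest)
    ≤⟨ N-repeat-++ B (mult b P) P rest B≤P ⟩
  mult b P * Ncyc B P + (length B ∸ 1) + N B rest
    ≤⟨ +-monoʳ-≤ _ (N-concat-expand-upper b B Ps B≤Ps) ⟩
  mult b P * Ncyc B P + (length B ∸ 1) + (blockSum b Ps (Ncyc B) + length Ps * (length B ∸ 1))
    ≡⟨ interchange (mult b P * Ncyc B P) (length B ∸ 1) (blockSum b Ps (Ncyc B)) (length Ps * (length B ∸ 1)) ⟩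
  (mult b P * Ncyc B P + blockSum b Ps (Ncyc B)) + ((length B ∸ 1) + length Ps * (length B ∸ 1)) ∎
  where
  open ≤-Reasoning
  rest = concat (map (expand b) Ps)

<⇒<ᵇ≡true : ∀ m n → m < n → (m <ᵇ n) ≡ true
<⇒<ᵇ≡true zero    (suc n) _         = refl
<⇒<ᵇ≡true (suc m) (suc n) (s≤s m<n) = <⇒<ᵇ≡true m n m<n

≥⇒<ᵇ≡false : ∀ m n → n ≤ m → (m <ᵇ n) ≡ false
≥⇒<ᵇ≡false m       zero    _         = refl
≥⇒<ᵇ≡false (suc m) (suc n) (s≤s n≤m) = ≥⇒<ᵇ≡false m n n≤m

≡ᵇ-refl : ∀ m → (m ≡ᵇ m) ≡ true
≡ᵇ-refl zero    = refl
≡ᵇ-refl (suc m) = ≡ᵇ-refl m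

≢⇒≡ᵇ≡false : ∀ m n → ¬ m ≡ n → (m ≡ᵇ n) ≡ false
≢⇒≡ᵇ≡false zero    zero    m≢n = contradiction refl m≢n
≢⇒≡ᵇ≡false zero    (suc n) _   = refl
≢⇒≡ᵇ≡false (suc m) zero    _   = refl
≢⇒≡ᵇ≡false (suc m) (suc n) m≢n = ≢⇒≡ᵇ≡false m n (m≢n ∘ cong suc)

sumOver : List ℕ → (ℕ → ℕ) → ℕ
sumOver []       g = 0
sumOver (d ∷ ds) g = g d + sumOver ds g

sumOver-cong : ∀ ds {g h} → (∀ d → g d ≡ h d) → sumOver ds g ≡ sumOver ds h
sumOver-cong []       g≗h = refl
sumOver-cong (d ∷ ds) g≗h = cong₂ _+_ (g≗h d) (sumOver-cong ds g≗h)

sumOver-+ : ∀ ds (g h : ℕ → ℕ) → sumOver ds (λ d → g d + h d) ≡ sumOver ds g + sumOver ds h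
sumOver-+ []       g h = refl
sumOver-+ (d ∷ ds) g h rewrite sumOver-+ ds g h = interchange (g d) (h d) (sumOver ds g) (sumOver ds h)

sumOver-* : ∀ ds c (g : ℕ → ℕ) → sumOver ds (λ d → c * g d) ≡ c * sumOver ds g
sumOver-* []       c g = sym (*-zeroʳ c)
sumOver-* (d ∷ ds) c g rewrite sumOver-* ds c g = sym (*-distribˡ-+ c (g d) (sumOver ds g))

sumOver-++ : ∀ xs ys (g : ℕ → ℕ) → sumOver (xs ++ ys) g ≡ sumOver xs g + sumOver ys g
sumOver-++ []       ys g = refl
sumOver-++ (x ∷ xs) ys g rewrite sumOver-++ xs ys g = sym (+-assoc (g x) _ _)

sumOver-upTo-suc : ∀ n (g : ℕ → ℕ) → sumOver (upTo (suc n)) g ≡ sumOver (upTo n) g + g n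
sumOver-upTo-suc n g = trans (cong (λ ds → sumOver ds g) (sym (applyUpTo-∷ʳ (λ x → x) n)))
  (trans (sumOver-++ (upTo n) (n ∷ []) g) (cong (sumOver (upTo n) g +_) (+-identityʳ (g n))))

sumOver-upTo-cong : ∀ n {g h} → (∀ d → d < n → g d ≡ h d) → sumOver (upTo n) g ≡ sumOver (upTo n) h
sumOver-upTo-cong zero    g≗h = refl
sumOver-upTo-cong (suc n) {g} {h} g≗h rewrite sumOver-upTo-suc n g | sumOver-upTo-suc n h =
  cong₂ _+_ (sumOver-upTo-cong n (λ d d<n → g≗h d (<-trans d<n (n<1+n n)))) (g≗h n (n<1+n n))

sumOver-upTo-const : ∀ n c → sumOver (upTo n) (λ _ → c) ≡ n * c
sumOver-upTo-const zero    c = refl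
sumOver-upTo-const (suc n) c rewrite sumOver-upTo-suc n (λ _ → c) | sumOver-upTo-const n c = +-comm (n * c) c

sumOver-upTo-select : ∀ n c (g : ℕ → ℕ) → sumOver (upTo n) (λ d → 𝟙 (c ≡ᵇ d) * g d) ≡ 𝟙 (c <ᵇ n) * g c
sumOver-upTo-select zero    c g = refl
sumOver-upTo-select (suc n) c g =
  trans (sumOver-upTo-suc n (λ d → 𝟙 (c ≡ᵇ d) * g d))
        (trans (cong (_+ 𝟙 (c ≡ᵇ n) * g n) (sumOver-upTo-select n c g)) last)
  where
  last : 𝟙 (c <ᵇ n) * g c + 𝟙 (c ≡ᵇ n) * g n ≡ 𝟙 (c <ᵇ suc n) * g c
  last with <-cmp c n
  ... | tri< c<n _ _ rewrite <⇒<ᵇ≡true c n c<n | <⇒<ᵇ≡true c (suc n) (<-trans c<n (n<1+n n))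
                           | ≢⇒≡ᵇ≡false c n (<⇒≢ c<n) = +-identityʳ _
  ... | tri≈ _ refl _ rewrite ≥⇒<ᵇ≡false c c ≤-refl | ≡ᵇ-refl c | <⇒<ᵇ≡true c (suc c) (n<1+n c) = refl
  ... | tri> _ c≢n c>n rewrite ≥⇒<ᵇ≡false c n (<⇒≤ c>n) | ≥⇒<ᵇ≡false c (suc n) c>n
                             | ≢⇒≡ᵇ≡false c n c≢n = refl

n<2^n : ∀ n → n < 2 ^ n
n<2^n zero    = s≤s z≤n
n<2^n (suc n) = +-mono-≤ (m^n>0 2 n) (≤-trans (n<2^n n) (m≤m+n (2 ^ n) 0))

weight-< : ∀ b d → d < b → weight b d ≡ 1
weight-< b d d<b rewrite <⇒<ᵇ≡true d b d<b = refl

weight-self : ∀ b → weight b b ≡ 2 ^ b ∸ b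
weight-self b rewrite ≥⇒<ᵇ≡false b b ≤-refl | ≡ᵇ-refl b = refl

weight-> : ∀ b d → b < d → weight b d ≡ 0
weight-> b d b<d rewrite ≥⇒<ᵇ≡false d b (<⇒≤ b<d) | ≢⇒≡ᵇ≡false d b (≢-sym (<⇒≢ b<d)) = refl

1≤weight : ∀ b d → d ≤ b → 1 ≤ weight b d
1≤weight b d d≤b with <-cmp d b
... | tri< d<b _ _ rewrite weight-< b d d<b = ≤-refl
... | tri≈ _ refl _ rewrite weight-self d = m<n⇒0<n∸m (n<2^n d)
... | tri> _ _ d>b = contradiction d≤b (<⇒≱ d>b)

sumOver-weight : ∀ b x → sumOver (upTo (suc b)) (λ d → weight b d * x) ≡ 2 ^ b * x
sumOver-weight b x = begin
  sumOver (upTo (suc b)) (λ d → weight b d * x)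
    ≡⟨ sumOver-upTo-suc b (λ d → weight b d * x) ⟩
  sumOver (upTo b) (λ d → weight b d * x) + weight b b * x
    ≡⟨ cong₂ _+_ (sumOver-upTo-cong b (λ d d<b → trans (cong (_* x) (weight-< b d d<b)) (+-identityʳ x)))
                 (cong (_* x) (weight-self b)) ⟩
  sumOver (upTo b) (λ _ → x) + (2 ^ b ∸ b) * x
    ≡⟨ cong (_+ (2 ^ b ∸ b) * x) (sumOver-upTo-const b x) ⟩
  b * x + (2 ^ b ∸ b) * x
    ≡⟨ sym (*-distribʳ-+ x b (2 ^ b ∸ b)) ⟩
  (b + (2 ^ b ∸ b)) * x
    ≡⟨ cong (_* x) (m+[n∸m]≡n (<⇒≤ (n<2^n b))) ⟩
  2 ^ b * x ∎
  where open ≡-Reasoning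

sumOver-weight-select : ∀ b c x → sumOver (upTo (suc b)) (λ d → weight b d * (𝟙 (c ≡ᵇ d) * x)) ≡ weight b c * x
sumOver-weight-select b c x = begin
  sumOver (upTo (suc b)) (λ d → weight b d * (𝟙 (c ≡ᵇ d) * x))
    ≡⟨ sumOver-cong (upTo (suc b)) (λ d → x*[y*z]≡y*[x*z] (weight b d) (𝟙 (c ≡ᵇ d)) x) ⟩
  sumOver (upTo (suc b)) (λ d → 𝟙 (c ≡ᵇ d) * (weight b d * x))
    ≡⟨ sumOver-upTo-select (suc b) c (λ d → weight b d * x) ⟩
  𝟙 (c <ᵇ suc b) * (weight b c * x)
    ≡⟨ in-range ⟩
  weight b c * x ∎
  where
  open ≡-Reasoning
  in-range : 𝟙 (c <ᵇ suc b) * (weight b c * x) ≡ weight b c * x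
  in-range with c ≤? b
  ... | yes c≤b rewrite <⇒<ᵇ≡true c (suc b) (s≤s c≤b) = +-identityʳ _
  ... | no c≰b rewrite ≥⇒<ᵇ≡false c (suc b) (≰⇒> c≰b) | weight-> b c (≰⇒> c≰b) = refl

νd-frac : ∀ b d → νd b d ≡ frac (weight b d) (2 ^ b)
νd-frac b d with d <ᵇ b
... | true = refl
... | false with d ≡ᵇ b
... | true  = refl
... | false = sym (frac-0 (2 ^ b))

ν-frac : ∀ b B → ν b B ≡ frac (mult b B) ((2 ^ b) ^ length B)
ν-frac b []       = refl
ν-frac b (d ∷ ds) = trans (cong₂ ℚ._*_ (νd-frac b d) (ν-frac b ds))
                          (frac-*-frac (weight b d) (mult b ds) (2 ^ b) ((2 ^ b) ^ length ds))

wordSum : ℕ → ℕ → (Block → ℕ) → ℕ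
wordSum b zero    f = f []
wordSum b (suc w) f = sumOver (upTo (suc b)) (λ d → weight b d * wordSum b w (λ P → f (d ∷ P)))

wordSum-cong : ∀ b w {f g : Block → ℕ} → (∀ P → length P ≡ w → f P ≡ g P) → wordSum b w f ≡ wordSum b w g
wordSum-cong b zero    f≗g = f≗g [] refl
wordSum-cong b (suc w) f≗g = sumOver-cong (upTo (suc b))
  (λ d → cong (weight b d *_) (wordSum-cong b w (λ P eq → f≗g (d ∷ P) (cong suc eq))))

wordSum-+ : ∀ b w (f g : Block → ℕ) → wordSum b w (λ P → f P + g P) ≡ wordSum b w f + wordSum b w g
wordSum-+ b zero    f g = refl
wordSum-+ b (suc w) f g = trans
  (sumOver-cong (upTo (suc b)) (λ d → trans (cong (weight b d *_) (wordSum-+ b w (λ P → f (d ∷ P)) (λ P → g (d ∷ P))))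
                                            (*-distribˡ-+ (weight b d) _ _)))
  (sumOver-+ (upTo (suc b)) (λ d → weight b d * wordSum b w (λ P → f (d ∷ P)))
                            (λ d → weight b d * wordSum b w (λ P → g (d ∷ P))))

wordSum-* : ∀ b w c (f : Block → ℕ) → wordSum b w (λ P → c * f P) ≡ c * wordSum b w f
wordSum-* b zero    c f = refl
wordSum-* b (suc w) c f = trans
  (sumOver-cong (upTo (suc b)) (λ d → trans (cong (weight b d *_) (wordSum-* b w c _)) (x*[y*z]≡y*[x*z] (weight b d) c _)))
  (sumOver-* (upTo (suc b)) c _)

wordSum-const : ∀ b w c → wordSum b w (λ _ → c) ≡ (2 ^ b) ^ w * c
wordSum-const b zero    c = sym (+-identityʳ c)
wordSum-const b (suc w) c = trans (sumOver-cong (upTo (suc b)) (λ d → cong (weight b d *_) (wordSum-const b w c)))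
  (trans (sumOver-weight b ((2 ^ b) ^ w * c)) (sym (*-assoc (2 ^ b) _ c)))

wordSum-++ : ∀ b u v (f : Block → ℕ) → wordSum b (u + v) f ≡ wordSum b u (λ X → wordSum b v (λ Y → f (X ++ Y)))
wordSum-++ b zero    v f = refl
wordSum-++ b (suc u) v f = sumOver-cong (upTo (suc b)) (λ d → cong (weight b d *_) (wordSum-++ b u v (λ P → f (d ∷ P))))

wordSum-sumOver : ∀ b v ds (c : ℕ → ℕ) (g : ℕ → Block → ℕ) →
  wordSum b v (λ Y → sumOver ds (λ d → c d * g d Y)) ≡ sumOver ds (λ d → c d * wordSum b v (g d))
wordSum-sumOver b v []       c g = trans (wordSum-const b v 0) (*-zeroʳ ((2 ^ b) ^ v))
wordSum-sumOver b v (d ∷ ds) c g = trans (wordSum-+ b v (λ Y → c d * g d Y) (λ Y → sumOver ds (λ d′ → c d′ * g d′ Y)))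
  (cong₂ _+_ (wordSum-* b v (c d) (g d)) (wordSum-sumOver b v ds c g))

wordSum-swap : ∀ b u v (h : Block → Block → ℕ) →
  wordSum b u (λ X → wordSum b v (λ Y → h X Y)) ≡ wordSum b v (λ Y → wordSum b u (λ X → h X Y))
wordSum-swap b zero    v h = refl
wordSum-swap b (suc u) v h = trans
  (sumOver-cong (upTo (suc b)) (λ d → cong (weight b d *_) (wordSum-swap b u v (λ X Y → h (d ∷ X) Y))))
  (sym (wordSum-sumOver b v (upTo (suc b)) (weight b) (λ d Y → wordSum b u (λ X → h (d ∷ X) Y))))

occ-∷ : ∀ c B d P → occ (c ∷ B) (d ∷ P) ≡ 𝟙 (c ≡ᵇ d) * occ B P
occ-∷ c B d P with c ≡ᵇ d
... | true  = sym (+-identityʳ _)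
... | false = refl

wordSum-occ : ∀ b B e → wordSum b (length B + e) (occ B) ≡ mult b B * (2 ^ b) ^ e
wordSum-occ b []      e = trans (wordSum-const b e 1) (trans (*-identityʳ _) (sym (+-identityʳ _)))
wordSum-occ b (c ∷ B) e = trans
  (sumOver-cong (upTo (suc b)) (λ d → cong (weight b d *_) (begin
    wordSum b (length B + e) (λ P → occ (c ∷ B) (d ∷ P))
      ≡⟨ wordSum-cong b (length B + e) (λ P _ → occ-∷ c B d P) ⟩
    wordSum b (length B + e) (λ P → 𝟙 (c ≡ᵇ d) * occ B P)
      ≡⟨ wordSum-* b (length B + e) (𝟙 (c ≡ᵇ d)) (occ B) ⟩
    𝟙 (c ≡ᵇ d) * wordSum b (length B + e) (occ B)
      ≡⟨ cong (𝟙 (c ≡ᵇ d) *_) (wordSum-occ b B e) ⟩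
    𝟙 (c ≡ᵇ d) * (mult b B * (2 ^ b) ^ e) ∎)))
  (trans (sumOver-weight-select b c (mult b B * (2 ^ b) ^ e)) (sym (*-assoc (weight b c) (mult b B) _)))
  where open ≡-Reasoning

m*[w*x]+w*[t*[m*x]]≡[1+t]*[m*[w*x]] : ∀ m w x t → m * (w * x) + w * (t * (m * x)) ≡ suc t * (m * (w * x))
m*[w*x]+w*[t*[m*x]]≡[1+t]*[m*[w*x]] = solve-∀

wordSum-N-∷ : ∀ b B n → wordSum b (suc n) (N B) ≡ wordSum b (suc n) (occ B) + 2 ^ b * wordSum b n (N B)
wordSum-N-∷ b B n = trans
  (sumOver-cong (upTo (suc b)) (λ d → trans (cong (weight b d *_) (wordSum-+ b n (λ P → occ B (d ∷ P)) (N B)))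
                                            (*-distribˡ-+ (weight b d) _ _)))
  (trans (sumOver-+ (upTo (suc b)) (λ d → weight b d * wordSum b n (λ P → occ B (d ∷ P))) (λ d → weight b d * wordSum b n (N B)))
         (cong (wordSum b (suc n) (occ B) +_) (sumOver-weight b (wordSum b n (N B)))))

wordSum-N : ∀ b c B t → wordSum b (length (c ∷ B) + t) (N (c ∷ B)) ≡ suc t * (mult b (c ∷ B) * (2 ^ b) ^ t)
wordSum-N b c B zero = begin
  wordSum b (suc (length B + 0)) (N (c ∷ B))
    ≡⟨ wordSum-N-∷ b (c ∷ B) (length B + 0) ⟩
  wordSum b (length (c ∷ B) + 0) (occ (c ∷ B)) + 2 ^ b * wordSum b (length B + 0) (N (c ∷ B))
    ≡⟨ cong₂ _+_ (wordSum-occ b (c ∷ B) 0) (cong (2 ^ b *_) (trans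
         (wordSum-cong b (length B + 0) (λ P eq → N-short (c ∷ B) P (s≤s (≤-reflexive (trans eq (+-identityʳ _))))))
         (wordSum-const b (length B + 0) 0))) ⟩
  mult b (c ∷ B) * 1 + 2 ^ b * ((2 ^ b) ^ (length B + 0) * 0)
    ≡⟨ cong (λ z → mult b (c ∷ B) * 1 + 2 ^ b * z) (*-zeroʳ ((2 ^ b) ^ (length B + 0))) ⟩
  mult b (c ∷ B) * 1 + 2 ^ b * 0
    ≡⟨ cong (mult b (c ∷ B) * 1 +_) (*-zeroʳ (2 ^ b)) ⟩
  1 * (mult b (c ∷ B) * 1) ∎
  where open ≡-Reasoning
wordSum-N b c B (suc t) = begin
  wordSum b (m + suc t) (N (c ∷ B))
    ≡⟨ cong (λ n → wordSum b n (N (c ∷ B))) (+-suc m t) ⟩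
  wordSum b (suc (m + t)) (N (c ∷ B))
    ≡⟨ wordSum-N-∷ b (c ∷ B) (m + t) ⟩
  wordSum b (suc (m + t)) (occ (c ∷ B)) + 2 ^ b * wordSum b (m + t) (N (c ∷ B))
    ≡⟨ cong₂ _+_ (trans (cong (λ n → wordSum b n (occ (c ∷ B))) (sym (+-suc m t))) (wordSum-occ b (c ∷ B) (suc t)))
                 (cong (2 ^ b *_) (wordSum-N b c B t)) ⟩
  mult b (c ∷ B) * (2 ^ b * (2 ^ b) ^ t) + 2 ^ b * (suc t * (mult b (c ∷ B) * (2 ^ b) ^ t))
    ≡⟨ m*[w*x]+w*[t*[m*x]]≡[1+t]*[m*[w*x]] (mult b (c ∷ B)) (2 ^ b) ((2 ^ b) ^ t) (suc t) ⟩
  suc (suc t) * (mult b (c ∷ B) * (2 ^ b) ^ suc t) ∎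
  where
  open ≡-Reasoning
  m = length (c ∷ B)

wordSum-Nin : ∀ b B e v →
  wordSum b v (λ Y → wordSum b (length B + e) (λ X → Nin B Y X)) ≡ v * (mult b B * (2 ^ b) ^ (v + e))
wordSum-Nin b B e zero    = trans (wordSum-const b (length B + e) 0) (*-zeroʳ ((2 ^ b) ^ (length B + e)))
wordSum-Nin b B e (suc v) = begin
  sumOver (upTo (suc b)) (λ d → weight b d * wordSum b v (λ Y → wordSum b u (λ X → Nin B (d ∷ Y) X)))
    ≡⟨ sumOver-cong (upTo (suc b)) (λ d → trans (cong (weight b d *_) (split-first-digit d)) (*-distribˡ-+ (weight b d) _ _)) ⟩
  sumOver (upTo (suc b)) (λ d → weight b d * wordSum b (v + u) (λ P → occ B (d ∷ P)) + weight b d * Q)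
    ≡⟨ sumOver-+ (upTo (suc b)) (λ d → weight b d * wordSum b (v + u) (λ P → occ B (d ∷ P))) (λ d → weight b d * Q) ⟩
  wordSum b (suc (v + u)) (occ B) + sumOver (upTo (suc b)) (λ d → weight b d * Q)
    ≡⟨ cong₂ _+_ (trans (cong (λ n → wordSum b n (occ B)) v+u≡) (wordSum-occ b B (suc v + e))) (sumOver-weight b Q) ⟩
  mult b B * (2 ^ b * (2 ^ b) ^ (v + e)) + 2 ^ b * Q
    ≡⟨ m*[w*x]+w*[t*[m*x]]≡[1+t]*[m*[w*x]] (mult b B) (2 ^ b) ((2 ^ b) ^ (v + e)) v ⟩
  suc v * (mult b B * (2 ^ b) ^ (suc v + e)) ∎
  where
  open ≡-Reasoning
  u = length B + e
  Q = v * (mult b B * (2 ^ b) ^ (v + e))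
  v+u≡ : suc (v + u) ≡ length B + suc (v + e)
  v+u≡ = trans (cong suc (trans (sym (+-assoc v (length B) e)) (trans (cong (_+ e) (+-comm v (length B))) (+-assoc (length B) v e))))
               (sym (+-suc (length B) (v + e)))
  split-first-digit : ∀ d → wordSum b v (λ Y → wordSum b u (λ X → occ B (d ∷ Y ++ X) + Nin B Y X))
             ≡ wordSum b (v + u) (λ P → occ B (d ∷ P)) + Q
  split-first-digit d = trans (wordSum-cong b v (λ Y _ → wordSum-+ b u (λ X → occ B (d ∷ Y ++ X)) (λ X → Nin B Y X)))
    (trans (wordSum-+ b v (λ Y → wordSum b u (λ X → occ B (d ∷ Y ++ X))) (λ Y → wordSum b u (λ X → Nin B Y X)))
      (cong₂ _+_ (sym (wordSum-++ b v u (λ P → occ B (d ∷ P)))) (wordSum-Nin b B e v)))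

-- Splitting a word of length |B| + e + (|B| - 1) as X ++ Y with |Y| = |B| - 1, the cyclic occurrences
-- are the linear ones plus those starting in Y and wrapping around into X.
wordSum-Ncyc-split : ∀ b c B e → let BB = c ∷ B; w = (length BB + e) + length B in
  wordSum b w (Ncyc BB) ≡ wordSum b w (N BB) + length B * (mult b BB * (2 ^ b) ^ (length B + e))
wordSum-Ncyc-split b c B e = begin
  wordSum b (u + m′) (Ncyc BB)
    ≡⟨ wordSum-++ b u m′ (Ncyc BB) ⟩
  wordSum b u (λ X → wordSum b m′ (λ Y → Ncyc BB (X ++ Y)))
    ≡⟨ wordSum-cong b u (λ X |X| → wordSum-cong b m′ (λ Y |Y| → Ncyc-++ X Y |X| |Y|)) ⟩
  wordSum b u (λ X → wordSum b m′ (λ Y → N BB (X ++ Y) + Nin BB Y X))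
    ≡⟨ wordSum-cong b u (λ X _ → wordSum-+ b m′ (λ Y → N BB (X ++ Y)) (λ Y → Nin BB Y X)) ⟩
  wordSum b u (λ X → wordSum b m′ (λ Y → N BB (X ++ Y)) + wordSum b m′ (λ Y → Nin BB Y X))
    ≡⟨ wordSum-+ b u (λ X → wordSum b m′ (λ Y → N BB (X ++ Y))) (λ X → wordSum b m′ (λ Y → Nin BB Y X)) ⟩
  wordSum b u (λ X → wordSum b m′ (λ Y → N BB (X ++ Y))) + wordSum b u (λ X → wordSum b m′ (λ Y → Nin BB Y X))
    ≡⟨ cong₂ _+_ (sym (wordSum-++ b u m′ (N BB)))
                 (trans (wordSum-swap b u m′ (λ X Y → Nin BB Y X)) (wordSum-Nin b BB e m′)) ⟩
  wordSum b (u + m′) (N BB) + m′ * (mult b BB * (2 ^ b) ^ (m′ + e)) ∎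
  where
  open ≡-Reasoning
  BB = c ∷ B
  m′ = length B
  u = length BB + e
  Ncyc-++ : ∀ X Y → length X ≡ u → length Y ≡ m′ → Ncyc BB (X ++ Y) ≡ N BB (X ++ Y) + Nin BB Y X
  Ncyc-++ X Y |X| |Y| = trans (Nin-++ˡ BB X Y (X ++ Y)) (cong₂ _+_
    (trans (Nin-++ʳ BB X Y (X ++ Y) (s≤s (≤-reflexive (sym |Y|))))
           (sym (trans (N-++ BB X Y) (trans (cong (Nin BB X Y +_) (N-short BB Y (s≤s (≤-reflexive |Y|)))) (+-identityʳ _)))))
    (Nin-++ʳ BB Y X Y (s≤s (subst (m′ ≤_) (sym |X|) (≤-trans (n≤1+n m′) (m≤m+n (suc m′) e))))))

wordSum-Ncyc : ∀ b c B t → length B ≤ t →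
  wordSum b (length (c ∷ B) + t) (Ncyc (c ∷ B)) ≡ (length (c ∷ B) + t) * (mult b (c ∷ B) * (2 ^ b) ^ t)
wordSum-Ncyc b c B t m′≤t with m≤n⇒∃[o]m+o≡n m′≤t
... | e , refl = begin
  wordSum b (m + (m′ + e)) (Ncyc (c ∷ B))
    ≡⟨ cong (λ n → wordSum b n (Ncyc (c ∷ B))) w≡ ⟩
  wordSum b ((m + e) + m′) (Ncyc (c ∷ B))
    ≡⟨ wordSum-Ncyc-split b c B e ⟩
  wordSum b ((m + e) + m′) (N (c ∷ B)) + m′ * Q
    ≡⟨ cong (λ n → wordSum b n (N (c ∷ B)) + m′ * Q) (sym w≡) ⟩
  wordSum b (m + (m′ + e)) (N (c ∷ B)) + m′ * Q
    ≡⟨ cong (_+ m′ * Q) (wordSum-N b c B (m′ + e)) ⟩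
  suc (m′ + e) * Q + m′ * Q
    ≡⟨ trans (sym (*-distribʳ-+ Q (suc (m′ + e)) m′)) (cong (λ n → suc n * Q) (+-comm (m′ + e) m′)) ⟩
  (m + (m′ + e)) * Q ∎
  where
  open ≡-Reasoning
  m′ = length B
  m = suc m′
  Q = mult b (c ∷ B) * (2 ^ b) ^ (m′ + e)
  w≡ : m + (m′ + e) ≡ (m + e) + m′
  w≡ = trans (cong (m +_) (+-comm m′ e)) (sym (+-assoc m e m′))

blockSum-++ : ∀ b xs ys (f : Block → ℕ) → blockSum b (xs ++ ys) f ≡ blockSum b xs f + blockSum b ys f
blockSum-++ b []       ys f = refl
blockSum-++ b (x ∷ xs) ys f rewrite blockSum-++ b xs ys f = sym (+-assoc (mult b x * f x) _ _)

blockSum-map-∷ : ∀ b d Ps (f : Block → ℕ) → blockSum b (map (d ∷_) Ps) f ≡ weight b d * blockSum b Ps (λ P → f (d ∷ P))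
blockSum-map-∷ b d []       f = sym (*-zeroʳ (weight b d))
blockSum-map-∷ b d (P ∷ Ps) f rewrite blockSum-map-∷ b d Ps f =
  trans (cong (_+ weight b d * blockSum b Ps (λ P → f (d ∷ P))) (*-assoc (weight b d) (mult b P) (f (d ∷ P))))
        (sym (*-distribˡ-+ (weight b d) _ _))

blockSum-concat : ∀ b (h : ℕ → List Block) ds (f : Block → ℕ) →
  blockSum b (concat (map h ds)) f ≡ sumOver ds (λ d → blockSum b (h d) f)
blockSum-concat b h []       f = refl
blockSum-concat b h (d ∷ ds) f = trans (blockSum-++ b (h d) _ f) (cong (blockSum b (h d) f +_) (blockSum-concat b h ds f))

blockSum-allBlocks : ∀ b w (f : Block → ℕ) → blockSum b (allBlocks b w) f ≡ wordSum b w f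
blockSum-allBlocks b zero    f = trans (+-identityʳ _) (*-identityˡ (f []))
blockSum-allBlocks b (suc w) f = trans (blockSum-concat b (λ d → map (d ∷_) (allBlocks b w)) (upTo (suc b)) f)
  (sumOver-cong (upTo (suc b)) (λ d → trans (blockSum-map-∷ b d (allBlocks b w) f)
                                            (cong (weight b d *_) (blockSum-allBlocks b w (λ P → f (d ∷ P))))))

allBlocks-length : ∀ b w → All (λ P → length P ≡ w) (allBlocks b w)
allBlocks-length b zero    = refl ∷ []
allBlocks-length b (suc w) = concat⁺ (map⁺ (applyUpTo⁺₂ (λ d → d) (suc b)
  (λ d → map⁺ (All.map (cong suc) (allBlocks-length b w)))))

allBlocks-digits : ∀ b w → All (All (_≤ b)) (allBlocks b w)
allBlocks-digits b zero    = [] ∷ []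
allBlocks-digits b (suc w) = concat⁺ (map⁺ (applyUpTo⁺₁ (λ d → d) (suc b)
  (λ d<1+b → map⁺ (All.map (≤-pred d<1+b ∷_) (allBlocks-digits b w)))))

length-concat-map : ∀ {A : Set} (h : ℕ → List A) ds → length (concat (map h ds)) ≡ sumOver ds (λ d → length (h d))
length-concat-map h []       = refl
length-concat-map h (d ∷ ds) = trans (length-++ (h d)) (cong (length (h d) +_) (length-concat-map h ds))

length-allBlocks : ∀ b w → length (allBlocks b w) ≡ suc b ^ w
length-allBlocks b zero    = refl
length-allBlocks b (suc w) = trans (length-concat-map (λ d → map (d ∷_) (allBlocks b w)) (upTo (suc b)))
  (trans (sumOver-cong (upTo (suc b)) (λ d → trans (length-map (d ∷_) (allBlocks b w)) (length-allBlocks b w)))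
         (sumOver-upTo-const (suc b) (suc b ^ w)))

Pbw-digits : ∀ b w → All (_≤ b) (Pbw b w)
Pbw-digits b w = concat⁺ (map⁺ (All.map (λ {P} P≤b → concat⁺ (replicate⁺ (mult b P) P≤b)) (allBlocks-digits b w)))

isPrefix-mult≡0 : ∀ b B y → mult b B ≡ 0 → All (_≤ b) y → isPrefix B y ≡ false
isPrefix-mult≡0 b []      y       ()
isPrefix-mult≡0 b (c ∷ B) []      _   _ = refl
isPrefix-mult≡0 b (c ∷ B) (d ∷ y) M≡0 (d≤b ∷ y≤b) with c ≡ᵇ d in c≡ᵇd
... | false = refl
... | true with m*n≡0⇒m≡0∨n≡0 (weight b c) M≡0
...   | inj₁ wc≡0 = contradiction wc≡0 (n>0⇒n≢0 (1≤weight b c (subst (_≤ b) (sym c≡d) d≤b)))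
  where c≡d = ≡ᵇ⇒≡ c d (subst T (sym c≡ᵇd) tt)
...   | inj₂ M′≡0 = isPrefix-mult≡0 b B y M′≡0 y≤b

N-mult≡0 : ∀ b B y → mult b B ≡ 0 → All (_≤ b) y → N B y ≡ 0
N-mult≡0 b B []      M≡0 _ = refl
N-mult≡0 b B (x ∷ y) M≡0 (x≤b ∷ y≤b) rewrite isPrefix-mult≡0 b B (x ∷ y) M≡0 (x≤b ∷ y≤b) =
  N-mult≡0 b B y M≡0 y≤b

length-Pbw : ∀ b w → length (Pbw b w) ≡ w * (2 ^ b) ^ w
length-Pbw b w = begin
  length (Pbw b w)                    ≡⟨ length-concat-expand b (allBlocks b w) ⟩
  blockSum b (allBlocks b w) length   ≡⟨ blockSum-allBlocks b w length ⟩
  wordSum b w length                  ≡⟨ wordSum-cong b w (λ _ |P| → |P|) ⟩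
  wordSum b w (λ _ → w)               ≡⟨ wordSum-const b w w ⟩
  (2 ^ b) ^ w * w                     ≡⟨ *-comm _ w ⟩
  w * (2 ^ b) ^ w ∎
  where open ≡-Reasoning

[1+b]^2≤2^b : ∀ b → 6 ≤ b → suc b ^ 2 ≤ 2 ^ b
[1+b]^2≤2^b b 6≤b with m≤n⇒∃[o]m+o≡n 6≤b
... | c , refl = from6 c
  where
  square-step : ∀ c → 2 * ((7 + c) * ((7 + c) * 1)) ≡ (8 + c) * ((8 + c) * 1) + (c * c + 12 * c + 34)
  square-step = solve-∀
  from6 : ∀ c → suc (6 + c) ^ 2 ≤ 2 ^ (6 + c)
  from6 zero    = m≤m+n 49 15
  from6 (suc c) = ≤-trans (≤-trans (m≤m+n _ _) (≤-reflexive (sym (square-step c)))) (*-monoʳ-≤ 2 (from6 c))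

[1+b]^w≤[2^b]^t : ∀ b w t → 6 ≤ b → w ≤ 2 * t → suc b ^ w ≤ (2 ^ b) ^ t
[1+b]^w≤[2^b]^t b w t 6≤b w≤2t = begin
  suc b ^ w         ≤⟨ ^-monoʳ-≤ (suc b) w≤2t ⟩
  suc b ^ (2 * t)   ≡⟨ sym (^-*-assoc (suc b) 2 t) ⟩
  (suc b ^ 2) ^ t   ≤⟨ ^-monoˡ-≤ t ([1+b]^2≤2^b b 6≤b) ⟩
  (2 ^ b) ^ t ∎
  where open ≤-Reasoning

N-Pbw-lower : ∀ b c B t → suc t * (mult b (c ∷ B) * (2 ^ b) ^ t) ≤ N (c ∷ B) (Pbw b (length (c ∷ B) + t))
N-Pbw-lower b c B t = begin
  suc t * (mult b (c ∷ B) * (2 ^ b) ^ t)  ≡⟨ sym (wordSum-N b c B t) ⟩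
  wordSum b w (N (c ∷ B))                 ≡⟨ sym (blockSum-allBlocks b w (N (c ∷ B))) ⟩
  blockSum b (allBlocks b w) (N (c ∷ B))  ≤⟨ N-concat-expand-lower b (c ∷ B) (allBlocks b w) ⟩
  N (c ∷ B) (Pbw b w) ∎
  where
  open ≤-Reasoning
  w = length (c ∷ B) + t

N-Pbw-upper : ∀ b c B t → 6 ≤ b → length (c ∷ B) ≤ t →
  N (c ∷ B) (Pbw b (length (c ∷ B) + t)) ≤ (length (c ∷ B) + t + length B) * (mult b (c ∷ B) * (2 ^ b) ^ t)
N-Pbw-upper b c B t 6≤b m≤t with mult b (c ∷ B) ≟ 0
... | yes M≡0 = ≤-trans (≤-reflexive (N-mult≡0 b (c ∷ B) (Pbw b w) M≡0 (Pbw-digits b w))) z≤n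
  where w = length (c ∷ B) + t
... | no M≢0 = begin
  N (c ∷ B) (Pbw b w)
    ≤⟨ N-concat-expand-upper b (c ∷ B) (allBlocks b w) B-fits ⟩
  blockSum b (allBlocks b w) (Ncyc (c ∷ B)) + length (allBlocks b w) * m′
    ≡⟨ cong₂ (λ x y → x + y * m′)
         (trans (blockSum-allBlocks b w (Ncyc (c ∷ B))) (wordSum-Ncyc b c B t (≤-trans (n≤1+n m′) m≤t)))
         (length-allBlocks b w) ⟩
  w * Q + suc b ^ w * m′
    ≤⟨ +-monoʳ-≤ (w * Q) (*-monoˡ-≤ m′ seams≤Q) ⟩
  w * Q + Q * m′
    ≡⟨ trans (cong (w * Q +_) (*-comm Q m′)) (sym (*-distribʳ-+ Q w m′)) ⟩
  (w + m′) * Q ∎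
  where
  open ≤-Reasoning
  m′ = length B
  m = suc m′
  w = m + t
  Q = mult b (c ∷ B) * (2 ^ b) ^ t
  B-fits : All (λ P → m ≤ length P) (allBlocks b w)
  B-fits = All.map (λ |P| → subst (m ≤_) (sym |P|) (m≤m+n m t)) (allBlocks-length b w)
  w≤2t : w ≤ 2 * t
  w≤2t = ≤-trans (+-monoˡ-≤ t m≤t) (≤-reflexive (cong (t +_) (sym (+-identityʳ t))))
  seams≤Q : suc b ^ w ≤ Q
  seams≤Q = ≤-trans ([1+b]^w≤[2^b]^t b w t 6≤b w≤2t) (m≤n*m _ _ {{ℕ.≢-nonZero M≢0}})

ν*length-Pbw : ∀ b B t x → 1 ≤ length B + t →
  ν b B ℚ.* frac (length (Pbw b (length B + t))) 1 ℚ.* frac x (length B + t) ≡ frac (x * (mult b B * (2 ^ b) ^ t)) 1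
ν*length-Pbw b B t x 1≤w = begin
  ν b B ℚ.* frac L 1 ℚ.* frac x w              ≡⟨ cong (λ q → q ℚ.* frac L 1 ℚ.* frac x w) (ν-frac b B) ⟩
  frac M (W ^ m) ℚ.* frac L 1 ℚ.* frac x w     ≡⟨ cong (ℚ._* frac x w) (frac-*-frac M L (W ^ m) 1) ⟩
  frac (M * L) (W ^ m * 1) ℚ.* frac x w        ≡⟨ frac-*-frac (M * L) x (W ^ m * 1) w ⟩
  frac (M * L * x) (W ^ m * 1 * w)
    ≡⟨ frac-cong (M * L * x) (x * (M * W ^ t)) (W ^ m * 1 * w) 1 1≤denominator ≤-refl cross ⟩
  frac (x * (M * W ^ t)) 1 ∎
  where
  open ≡-Reasoning
  m = length B
  w = m + t
  W = 2 ^ b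
  M = mult b B
  L = length (Pbw b w)
  1≤denominator : 1 ≤ W ^ m * 1 * w
  1≤denominator = *-mono-≤ (*-mono-≤ (subst (_≤ W ^ m) (^-zeroˡ m) (^-monoˡ-≤ m (m^n>0 2 b))) ≤-refl) 1≤w
  rearrange : ∀ M w A C x → M * (w * (A * C)) * x * 1 ≡ x * (M * C) * (A * 1 * w)
  rearrange = solve-∀
  cross : M * L * x * 1 ≡ x * (M * W ^ t) * (W ^ m * 1 * w)
  cross = trans (cong (λ l → M * l * x * 1) (trans (length-Pbw b w) (cong (w *_) (^-distribˡ-+-* W m t))))
                (rearrange M w (W ^ m) (W ^ t) x)

Pbw-normal : ∀ b k c B t → 6 ≤ b → length (c ∷ B) ≤ k → 2 * k ≤ length (c ∷ B) + t →
  (ν b (c ∷ B) ℚ.* frac (length (Pbw b (length (c ∷ B) + t))) 1 ℚ.* (1ℚ ℚ.- frac k (length (c ∷ B) + t))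
     ℚ.≤ frac (N (c ∷ B) (Pbw b (length (c ∷ B) + t))) 1)
  × (frac (N (c ∷ B) (Pbw b (length (c ∷ B) + t))) 1
     ℚ.≤ ν b (c ∷ B) ℚ.* frac (length (Pbw b (length (c ∷ B) + t))) 1 ℚ.* (1ℚ ℚ.+ frac k (length (c ∷ B) + t)))
Pbw-normal b k c B t 6≤b m≤k 2k≤w = lower , upper
  where
  open ℚ.≤-Reasoning
  BB = c ∷ B
  m′ = length B
  m = suc m′
  w = m + t
  Q = mult b BB * (2 ^ b) ^ t
  νL = ν b BB ℚ.* frac (length (Pbw b w)) 1
  k+k≤w : k + k ≤ w
  k+k≤w = ≤-trans (≤-reflexive (cong (k +_) (sym (+-identityʳ k)))) 2k≤w
  k≤w : k ≤ w
  k≤w = ≤-trans (m≤m+n k k) k+k≤w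
  m≤t : m ≤ t
  m≤t = +-cancelˡ-≤ m m t (≤-trans (+-mono-≤ m≤k m≤k) k+k≤w)
  m′≤k : m′ ≤ k
  m′≤k = ≤-trans (n≤1+n m′) m≤k
  w∸k≤1+t : w ∸ k ≤ suc t
  w∸k≤1+t = ≤-trans (∸-monoʳ-≤ w m≤k) (≤-trans (≤-reflexive (m+n∸m≡n m t)) (n≤1+n t))
  lower : νL ℚ.* (1ℚ ℚ.- frac k w) ℚ.≤ frac (N BB (Pbw b w)) 1
  lower = begin
    νL ℚ.* (1ℚ ℚ.- frac k w)   ≡⟨ cong (νL ℚ.*_) (1-frac k (m′ + t) k≤w) ⟩
    νL ℚ.* frac (w ∸ k) w      ≡⟨ ν*length-Pbw b BB t (w ∸ k) (s≤s z≤n) ⟩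
    frac ((w ∸ k) * Q) 1       ≤⟨ frac-mono (≤-trans (*-monoˡ-≤ Q w∸k≤1+t) (N-Pbw-lower b c B t)) ⟩
    frac (N BB (Pbw b w)) 1    ∎
  upper : frac (N BB (Pbw b w)) 1 ℚ.≤ νL ℚ.* (1ℚ ℚ.+ frac k w)
  upper = begin
    frac (N BB (Pbw b w)) 1    ≤⟨ frac-mono (≤-trans (N-Pbw-upper b c B t 6≤b m≤t) (*-monoˡ-≤ Q (+-monoʳ-≤ w m′≤k))) ⟩
    frac ((w + k) * Q) 1       ≡⟨ sym (ν*length-Pbw b BB t (w + k) (s≤s z≤n)) ⟩
    νL ℚ.* frac (w + k) w      ≡⟨ cong (νL ℚ.*_) (sym (1+frac k (m′ + t))) ⟩
    νL ℚ.* (1ℚ ℚ.+ frac k w)   ∎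

lemma6 : (b k w : ℕ) → 1 ≤ b → 1 ≤ k → 1 ≤ w → 6 ≤ b → 2 * k ≤ w →
    (m : ℕ) → 1 ≤ m → m ≤ k → (B : Block) → length B ≡ m →
      (ν b B ℚ.* frac (length (Pbw b w)) 1 ℚ.* (1ℚ ℚ.- frac k w) ℚ.≤ frac (N B (Pbw b w)) 1)
      × (frac (N B (Pbw b w)) 1 ℚ.≤ ν b B ℚ.* frac (length (Pbw b w)) 1 ℚ.* (1ℚ ℚ.+ frac k w))
lemma6 b k w _ _ _ 6≤b 2k≤w .(length (c ∷ B)) _ m≤k (c ∷ B) refl
  with m≤n⇒∃[o]m+o≡n (≤-trans m≤k (≤-trans (m≤m+n k (k + 0)) 2k≤w))
... | t , refl = Pbw-normal b k c B t 6≤b m≤k 2k≤w
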